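{- Let $G$ be a graph and $v\in V(G)$, and let $z_v(G)=Z(G)-Z(G-v)$. If $z_v(G)=1$ then $Z(G;\{v\})=Z(G)$, and if $z_v(G)=-1$ then $Z(G;\{v\})=Z(G)+1$.
   Context: All graphs are finite, simple and undirected; $G-v$ is obtained by deleting $v$. Zero forcing: for a set of blue vertices (others white), if a blue vertex $u$ has exactly one white neighbor $w$, then $w$ becomes blue; the closure of $B$ is the set of blue vertices after applying this rule until no change; $B$ is a zero forcing set if its closure is the whole vertex set. $Z(H)$ is the minimum size of a zero forcing set of $H$ and $Z(H;X)$ the minimum size of a zero forcing set of $H$ containing $X$. The quantity $z_v(G)$ is called the zero forcing spread of $v$. -}

module Defs where

open import Data.Nat using (ℕ; suc; _≤_)
open import Data.Bool using (Bool; true; false; T)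
open import Data.Fin using (Fin; punchIn)
open import Data.Fin.Subset using (Subset; _∈_; _⊆_; ∣_∣)
open import Data.Product using (Σ; _×_; _,_)
open import Relation.Binary.PropositionalEquality using (_≡_; _≢_)

record Graph (n : ℕ) : Set where
  field
    adj    : Fin n → Fin n → Bool
    sym    : ∀ i j → adj i j ≡ adj j i
    irrefl : ∀ i → adj i i ≡ false
open Graph public

Adj : ∀ {n} → Graph n → Fin n → Fin n → Set
Adj G i j = T (adj G i j)

delete : ∀ {n} → Graph (suc n) → Fin (suc n) → Graph n
delete G v = record
  { adj    = λ i j → adj G (punchIn v i) (punchIn v j)
  ; sym    = λ i j → sym G (punchIn v i) (punchIn v j)
  ; irrefl = λ i → irrefl G (punchIn v i)
  }

-- Closure of B under the zero forcing rule, as the least set containing B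
-- and closed under: if u is blue and every neighbour of u other than w is
-- blue, then w (a neighbour of u) becomes blue.
data InClosure {n} (G : Graph n) (B : Subset n) : Fin n → Set where
  base  : ∀ {w} → w ∈ B → InClosure G B w
  force : ∀ {w} (u : Fin n) → InClosure G B u → Adj G u w →
          (∀ x → Adj G u x → x ≢ w → InClosure G B x) →
          InClosure G B w

IsZeroForcingSet : ∀ {n} → Graph n → Subset n → Set
IsZeroForcingSet G B = ∀ w → InClosure G B w

IsZ : ∀ {n} → Graph n → ℕ → Set
IsZ {n} G k =
  Σ (Subset n) (λ B → IsZeroForcingSet G B × ∣ B ∣ ≡ k)
  × (∀ B → IsZeroForcingSet G B → k ≤ ∣ B ∣)

IsZRel : ∀ {n} → Graph n → Subset n → ℕ → Set
IsZRel {n} G X k =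
  Σ (Subset n) (λ B → X ⊆ B × IsZeroForcingSet G B × ∣ B ∣ ≡ k)
  × (∀ B → X ⊆ B → IsZeroForcingSet G B → k ≤ ∣ B ∣)

-- Adding v to a zero forcing set of G - v gives one of G, so Z(G;{v}) ≤ Z(G - v) + 1.
-- Conversely, from a zero forcing set C of G containing v we get one of G - v of
-- size at most |C|: drop v and, if v performs a force, add the vertex it forces
-- instead; so Z(G - v) ≤ Z(G;{v}). When z_v(G) = -1 a minimum zero forcing set of G
-- cannot contain v, and adding v to it is optimal.
module Submission where

open import Defs hiding (sym)
open import Data.Nat using (ℕ; suc; _≤_; _≤?_; s≤s)
open import Data.Nat.Properties using (≤-refl; ≤-trans; n≤1+n; 1+n≰n)
open import Data.Fin using (Fin; zero; suc; punchIn; punchOut; _≟_)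
open import Data.Fin.Properties using (punchIn-injective; punchIn-punchOut)
open import Data.Fin.Subset using (Subset; inside; outside; ⁅_⁆; _∈_; _∉_; _⊆_; ∣_∣)
open import Data.Fin.Subset.Properties using (x∈⁅x⁆; x∈⁅y⁆⇒x≡y; _∈?_; ⊆-refl)
open import Data.Vec using (_∷_; lookup; insertAt; removeAt; here; there; _[_]≔_)
open import Data.Vec.Properties using ([]=⇒lookup; lookup⇒[]=; insertAt-lookup; insertAt-punchIn; insertAt-removeAt; []≔-updates)
open import Data.Product using (Σ; ∃; _×_; _,_)
open import Data.Empty using (⊥-elim)
open import Function using (_∘_)
open import Relation.Nullary using (¬_; Dec; yes; no; ¬¬-map)
open import Relation.Nullary.Decidable using (decidable-stable; ¬¬-excluded-middle)
open import Relation.Binary.PropositionalEquality using (_≡_; refl; sym; trans; cong; subst; subst₂; _≢_; module ≡-Reasoning)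

punchIn-elim : ∀ {n} {P : Fin (suc n) → Set} (i : Fin (suc n)) →
               P i → (∀ j → P (punchIn i j)) → ∀ x → P x
punchIn-elim {P = P} i Pi Pj x with i ≟ x
... | yes refl = Pi
... | no i≢x = subst P (punchIn-punchOut i≢x) (Pj (punchOut i≢x))

x∈p⇒⁅x⁆⊆p : ∀ {n} {x : Fin n} {p : Subset n} → x ∈ p → ⁅ x ⁆ ⊆ p
x∈p⇒⁅x⁆⊆p {p = p} x∈p y∈⁅x⁆ = subst (_∈ p) (sym (x∈⁅y⁆⇒x≡y _ y∈⁅x⁆)) x∈p

∈-removeAt : ∀ {n} (p : Subset (suc n)) i {j} → punchIn i j ∈ p → j ∈ removeAt p i
∈-removeAt (_ ∷ _)     zero            (there j∈p) = j∈p
∈-removeAt (_ ∷ _ ∷ _) (suc i) {zero}  here        = here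
∈-removeAt (_ ∷ q ∷ p) (suc i) {suc j} (there j∈p) = there (∈-removeAt (q ∷ p) i j∈p)

∣insertAt-inside∣≡1+∣p∣ : ∀ {n} (p : Subset n) i → ∣ insertAt p i inside ∣ ≡ suc ∣ p ∣
∣insertAt-inside∣≡1+∣p∣ p             zero    = refl
∣insertAt-inside∣≡1+∣p∣ (inside ∷ p)  (suc i) = cong suc (∣insertAt-inside∣≡1+∣p∣ p i)
∣insertAt-inside∣≡1+∣p∣ (outside ∷ p) (suc i) = ∣insertAt-inside∣≡1+∣p∣ p i

i∈p⇒∣p∣≡1+∣removeAt∣ : ∀ {n} (p : Subset (suc n)) {i} → i ∈ p → ∣ p ∣ ≡ suc ∣ removeAt p i ∣
i∈p⇒∣p∣≡1+∣removeAt∣ p {i} i∈p = begin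
  ∣ p ∣                                       ≡⟨ cong ∣_∣ (sym (insertAt-removeAt p i)) ⟩
  ∣ insertAt (removeAt p i) i (lookup p i) ∣  ≡⟨ cong (λ b → ∣ insertAt (removeAt p i) i b ∣) ([]=⇒lookup i∈p) ⟩
  ∣ insertAt (removeAt p i) i inside ∣        ≡⟨ ∣insertAt-inside∣≡1+∣p∣ (removeAt p i) i ⟩
  suc ∣ removeAt p i ∣                        ∎
  where open ≡-Reasoning

p⊆p[i]≔inside : ∀ {n} (p : Subset n) i → p ⊆ p [ i ]≔ inside
p⊆p[i]≔inside (_ ∷ _) zero    here        = here
p⊆p[i]≔inside (_ ∷ _) zero    (there j∈p) = there j∈p
p⊆p[i]≔inside (_ ∷ _) (suc i) here        = here
p⊆p[i]≔inside (_ ∷ p) (suc i) (there j∈p) = there (p⊆p[i]≔inside p i j∈p)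

∣p[i]≔inside∣≤1+∣p∣ : ∀ {n} (p : Subset n) i → ∣ p [ i ]≔ inside ∣ ≤ suc ∣ p ∣
∣p[i]≔inside∣≤1+∣p∣ (inside ∷ p) zero    = n≤1+n _
∣p[i]≔inside∣≤1+∣p∣ (outside ∷ p) zero    = ≤-refl
∣p[i]≔inside∣≤1+∣p∣ (inside ∷ p) (suc i) = s≤s (∣p[i]≔inside∣≤1+∣p∣ p i)
∣p[i]≔inside∣≤1+∣p∣ (outside ∷ p) (suc i) = ∣p[i]≔inside∣≤1+∣p∣ p i

i∉p⇒∣p[i]≔inside∣≡1+∣p∣ : ∀ {n} (p : Subset n) {i} → i ∉ p → ∣ p [ i ]≔ inside ∣ ≡ suc ∣ p ∣
i∉p⇒∣p[i]≔inside∣≡1+∣p∣ (inside ∷ p) {zero}  i∉p = ⊥-elim (i∉p here)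
i∉p⇒∣p[i]≔inside∣≡1+∣p∣ (outside ∷ p) {zero}  i∉p = refl
i∉p⇒∣p[i]≔inside∣≡1+∣p∣ (inside ∷ p) {suc i} i∉p = cong suc (i∉p⇒∣p[i]≔inside∣≡1+∣p∣ p (i∉p ∘ there))
i∉p⇒∣p[i]≔inside∣≡1+∣p∣ (outside ∷ p) {suc i} i∉p = i∉p⇒∣p[i]≔inside∣≡1+∣p∣ p (i∉p ∘ there)

InClosure-mono : ∀ {n} (G : Graph n) {B C : Subset n} → B ⊆ C → ∀ {w} → InClosure G B w → InClosure G C w
InClosure-mono G B⊆C (base w∈B)       = base (B⊆C w∈B)
InClosure-mono G B⊆C (force u cu a k) = force u (InClosure-mono G B⊆C cu) a (λ x ax x≢w → InClosure-mono G B⊆C (k x ax x≢w))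

module _ {n} (G : Graph (suc n)) (v : Fin (suc n)) where
  private
    H = delete G v

  InClosure-insertAt : ∀ {B j} → InClosure H B j → InClosure G (insertAt B v inside) (punchIn v j)
  InClosure-insertAt {B} (base j∈B) = base (lookup⇒[]= _ _ (trans (insertAt-punchIn B v inside _) ([]=⇒lookup j∈B)))
  InClosure-insertAt {B} {j} (force u cu a k) = force (punchIn v u) (InClosure-insertAt cu) a
    (punchIn-elim {P = λ x → Adj G (punchIn v u) x → x ≢ punchIn v j → InClosure G (insertAt B v inside) x} v
      (λ _ _ → base (lookup⇒[]= v _ (insertAt-lookup B v inside)))
      (λ x ax x≢j → InClosure-insertAt (k x ax (x≢j ∘ cong (punchIn v)))))

  insertAt-IsZeroForcingSet : ∀ B → IsZeroForcingSet H B → IsZeroForcingSet G (insertAt B v inside)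
  insertAt-IsZeroForcingSet B zfsB = punchIn-elim v
    (base (lookup⇒[]= v _ (insertAt-lookup B v inside)))
    (λ j → InClosure-insertAt (zfsB j))

  Lifted : Subset n → Fin (suc n) → Set
  Lifted D x = ∀ x' → x ≡ punchIn v x' → InClosure H D x'

  VCanForce : Subset n → Fin n → Set
  VCanForce D w = Adj G v (punchIn v w) × (∀ y → Adj G v y → y ≢ punchIn v w → Lifted D y)

  VForceCovered : Subset n → Set
  VForceCovered D = ∀ w → VCanForce D w → InClosure H D w

  InClosure-restrict : ∀ {C D} → removeAt C v ⊆ D → VForceCovered D →
                       ∀ {x} → InClosure G C x → Lifted D x
  InClosure-restrict {C} C⊆D _ (base x∈C) x' refl = base (C⊆D (∈-removeAt C v x∈C))
  InClosure-restrict C⊆D covered {x} (force u cu a k) with v ≟ u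
  ... | yes refl = λ { x' refl → covered x' (a , λ y ay y≢x → InClosure-restrict C⊆D covered (k y ay y≢x)) }
  ... | no v≢u = λ x' x≡x' → force u' (InClosure-restrict C⊆D covered cu u' (sym u'↦u))
                               (subst₂ (Adj G) (sym u'↦u) x≡x' a) (forced-others x≡x')
    where
    u' = punchOut v≢u
    u'↦u : punchIn v u' ≡ u
    u'↦u = punchIn-punchOut v≢u
    forced-others : ∀ {x'} → x ≡ punchIn v x' → ∀ y → Adj H u' y → y ≢ x' → InClosure H _ y
    forced-others {x'} x≡x' y ay y≢x' = InClosure-restrict C⊆D covered
      (k (punchIn v y) (subst (λ z → Adj G z _) u'↦u ay) (λ y≡x → y≢x' (punchIn-injective v y x' (trans y≡x x≡x'))))
      y refl

  -- Whether v performs a force is not decidable here, hence the double negation.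
  restrict-IsZeroForcingSet : ∀ {C} → v ∈ C → IsZeroForcingSet G C →
    ¬ ¬ Σ (Subset n) (λ D → IsZeroForcingSet H D × ∣ D ∣ ≤ ∣ C ∣)
  restrict-IsZeroForcingSet {C} v∈C zfsC = ¬¬-map choose ¬¬-excluded-middle
    where
    C₀ = removeAt C v
    ∣C∣≡1+∣C₀∣ = i∈p⇒∣p∣≡1+∣removeAt∣ C v∈C
    zfs : ∀ {D} → C₀ ⊆ D → VForceCovered D → IsZeroForcingSet H D
    zfs C₀⊆D covered x' = InClosure-restrict C₀⊆D covered (zfsC (punchIn v x')) x' refl
    choose : Dec (∃ (VCanForce C₀)) → Σ (Subset n) (λ D → IsZeroForcingSet H D × ∣ D ∣ ≤ ∣ C ∣)
    choose (no noForce) = C₀ , zfs ⊆-refl (λ w f → ⊥-elim (noForce (w , f)))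
                             , subst (∣ C₀ ∣ ≤_) (sym ∣C∣≡1+∣C₀∣) (n≤1+n _)
    choose (yes (w , _ , others)) = D , zfs (p⊆p[i]≔inside C₀ w) covered
                                      , subst (∣ D ∣ ≤_) (sym ∣C∣≡1+∣C₀∣) (∣p[i]≔inside∣≤1+∣p∣ C₀ w)
      where
      D = C₀ [ w ]≔ inside
      covered : VForceCovered D
      covered x (ax , _) with x ≟ w
      ... | yes refl = base ([]≔-updates C₀ w)
      ... | no x≢w = InClosure-mono H (p⊆p[i]≔inside C₀ w)
                       (others (punchIn v x) ax (x≢w ∘ punchIn-injective v x w) x refl)

  Z-delete≤∣zfs∋v∣ : ∀ k → (∀ D → IsZeroForcingSet H D → k ≤ ∣ D ∣) →
                     ∀ C → v ∈ C → IsZeroForcingSet G C → k ≤ ∣ C ∣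
  Z-delete≤∣zfs∋v∣ k k≤Z C v∈C zfsC = decidable-stable (k ≤? ∣ C ∣)
    (¬¬-map (λ { (D , zfsD , ∣D∣≤∣C∣) → ≤-trans (k≤Z D zfsD) ∣D∣≤∣C∣ }) (restrict-IsZeroForcingSet v∈C zfsC))

proposition3p14 : ∀ {n} (G : Graph (suc n)) (v : Fin (suc n)) (z z' : ℕ) →
    IsZ G z → IsZ (delete G v) z' →
    (z ≡ suc z' → IsZRel G ⁅ v ⁆ z) × (suc z ≡ z' → IsZRel G ⁅ v ⁆ (suc z))
proposition3p14 G v z z' ((B , zfsB , ∣B∣≡z) , z≤Z) ((B' , zfsB' , ∣B'∣≡z') , z'≤Z') = spread1 , spread-1
  where
  spread1 : z ≡ suc z' → IsZRel G ⁅ v ⁆ z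
  spread1 z≡1+z' =
    ( insertAt B' v inside
    , x∈p⇒⁅x⁆⊆p (lookup⇒[]= v _ (insertAt-lookup B' v inside))
    , insertAt-IsZeroForcingSet G v B' zfsB'
    , trans (∣insertAt-inside∣≡1+∣p∣ B' v) (trans (cong suc ∣B'∣≡z') (sym z≡1+z')) )
    , λ C _ → z≤Z C

  spread-1 : suc z ≡ z' → IsZRel G ⁅ v ⁆ (suc z)
  spread-1 1+z≡z' = (B [ v ]≔ inside , x∈p⇒⁅x⁆⊆p ([]≔-updates B v)
                    , InClosure-mono G (p⊆p[i]≔inside B v) ∘ zfsB
                    , trans (i∉p⇒∣p[i]≔inside∣≡1+∣p∣ B v∉B) (cong suc ∣B∣≡z))
                  , λ C ⁅v⁆⊆C zfsC → subst (_≤ ∣ C ∣) (sym 1+z≡z')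
                      (Z-delete≤∣zfs∋v∣ G v z' z'≤Z' C (⁅v⁆⊆C (x∈⁅x⁆ v)) zfsC)
    where
    v∉B : v ∉ B
    v∉B v∈B = 1+n≰n (subst (_≤ z) (sym 1+z≡z') (subst (z' ≤_) ∣B∣≡z (Z-delete≤∣zfs∋v∣ G v z' z'≤Z' B v∈B zfsB)))
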